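{- Let $G=(V,E)$ and $H=(W,F)$ be finite simple graphs with $V\cap W=\emptyset$, $|V|=s$, $|W|=t$. Then \[ Q(G\vee H;x,y)=Q(G;x,y)+Q(H;x,y)+\left[(1+x)^s-1\right]\left[(1+x)^t-1\right]y-1. \]
   Context: For a finite simple graph $G=(V,E)$, $Q(G;x,y)=\sum_{X\subseteq V}x^{|X|}y^{k(G[X])}$, where $G[X]$ is the induced subgraph and $k$ the number of connected components (the null graph has $k=0$). The join $G\vee H$ is obtained from the disjoint union of $G$ and $H$ by adding an edge from every vertex of $G$ to every vertex of $H$. -}

module Defs where

open import Data.Nat using (ℕ; zero; suc; _+_; _≡ᵇ_; _<ᵇ_)
open import Data.Bool using (Bool; true; false; _∧_; _∨_; not; if_then_else_)
open import Data.Fin using (Fin; splitAt; toℕ)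
open import Data.Fin.Subset using (Subset; ∣_∣)
open import Data.Vec using (Vec; []; _∷_; lookup)
open import Data.List using (List; []; _∷_; map; _++_; foldr; allFin)
open import Data.Bool.ListAction using (any)
open import Data.Sum using (_⊎_; inj₁; inj₂)
open import Relation.Binary.PropositionalEquality using (_≡_; refl)
open import Algebra.Bundles using (CommutativeRing)
open import Level using (Level)

record Graph (n : ℕ) : Set where
  field
    adj    : Fin n → Fin n → Bool
    sym    : ∀ u v → adj u v ≡ adj v u
    irrefl : ∀ v → adj v v ≡ false
open Graph public

_∈ᵇ_ : ∀ {n} → Fin n → Subset n → Bool
v ∈ᵇ X = lookup X v

allSubsets : (n : ℕ) → List (Subset n)
allSubsets zero = [] ∷ []
allSubsets (suc n) = map (false ∷_) (allSubsets n) ++ map (true ∷_) (allSubsets n)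

-- reach G X j u v : there is a walk in the induced subgraph G[X]
-- from u to v with at most j edges
reach : ∀ {n} → Graph n → Subset n → ℕ → Fin n → Fin n → Bool
reach G X zero u v = (u ∈ᵇ X) ∧ (v ∈ᵇ X) ∧ (toℕ u ≡ᵇ toℕ v)
reach {n} G X (suc j) u v =
  reach G X j u v ∨ any (λ w → reach G X j u w ∧ adj G w v ∧ (v ∈ᵇ X)) (allFin n)

-- u and v lie in the same connected component of G[X]
-- (a walk, if it exists, can be taken with at most n edges)
connected : ∀ {n} → Graph n → Subset n → Fin n → Fin n → Bool
connected {n} G X u v = reach G X n u v

-- number of connected components of G[X]: the number of vertices of X
-- that are the smallest vertex of their component (0 for the null graph)
components : ∀ {n} → Graph n → Subset n → ℕ
components {n} G X =
  foldr (λ v acc → (if (v ∈ᵇ X) ∧ not (any (λ u → (toℕ u <ᵇ toℕ v) ∧ connected G X u v) (allFin n))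
                    then 1 else 0) + acc) 0 (allFin n)

-- join of G (on Fin s) and H (on Fin t): vertex set Fin (s + t), where the
-- first s vertices are a copy of V and the last t a (disjoint) copy of W
joinAdj : ∀ {s t} → Graph s → Graph t → Fin (s + t) → Fin (s + t) → Bool
joinAdj {s} G H u v with splitAt s u | splitAt s v
... | inj₁ a | inj₁ b = adj G a b
... | inj₂ a | inj₂ b = adj H a b
... | inj₁ _ | inj₂ _ = true
... | inj₂ _ | inj₁ _ = true

joinSym : ∀ {s t} (G : Graph s) (H : Graph t) u v → joinAdj G H u v ≡ joinAdj G H v u
joinSym {s} G H u v with splitAt s u | splitAt s v
... | inj₁ a | inj₁ b = sym G a b
... | inj₂ a | inj₂ b = sym H a b
... | inj₁ _ | inj₂ _ = refl
... | inj₂ _ | inj₁ _ = refl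

joinIrrefl : ∀ {s t} (G : Graph s) (H : Graph t) v → joinAdj G H v v ≡ false
joinIrrefl {s} G H v with splitAt s v
... | inj₁ a = irrefl G a
... | inj₂ a = irrefl H a

_⋁_ : ∀ {s t} → Graph s → Graph t → Graph (s + t)
G ⋁ H = record { adj = joinAdj G H ; sym = joinSym G H ; irrefl = joinIrrefl G H }

-- The bivariate polynomial Q(G;x,y) = Σ_{X ⊆ V} x^|X| y^{k(G[X])}, evaluated in
-- an arbitrary commutative ring (an identity of integer polynomials in x,y is
-- the same as an identity holding for all x,y in every commutative ring).
module Poly {c ℓ : Level} (R : CommutativeRing c ℓ) where
  open CommutativeRing R renaming (_+_ to _+R_; _*_ to _*R_)

  pow : Carrier → ℕ → Carrier
  pow a zero = 1#
  pow a (suc k) = a *R pow a k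

  Q : ∀ {n} → Graph n → Carrier → Carrier → Carrier
  Q {n} G x y = foldr (λ X acc → pow x ∣ X ∣ *R pow y (components G X) +R acc) 0# (allSubsets n)

module Submission where

-- Q(G ∨ H) is a sum over vertex subsets of G ∨ H, i.e. over the pairs X ++ Y
-- with X ⊆ V and Y ⊆ W.  The induced subgraph (G ∨ H)[X ++ Y] is a copy of
-- G[X] when Y = ∅, a copy of H[Y] when X = ∅, and connected when both are
-- nonempty (every vertex of X is adjacent to every vertex of Y).  Hence
--   Q(G ∨ H) = Q(G) + Σ_{∅≠Y} x^|Y| y^k(H[Y]) + y (Σ_{∅≠X} x^|X|) (Σ_{∅≠Y} x^|Y|),
-- and Q(H) − 1 and (1+x)^n − 1 are exactly these sums over nonempty subsets.

open import Defs hiding (sym)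
open import Data.Nat using (ℕ)
open import Algebra.Bundles using (CommutativeRing)
open import Level using (Level)

module Components where

  open import Data.Nat using (zero; suc; _+_; _≤_; _≤′_; ≤′-refl; ≤′-step; _≡ᵇ_; _<ᵇ_; z≤n; s≤s)
  open import Data.Nat.Properties
    using (+-assoc; +-identityʳ; +-suc; ≤-trans; ≤-reflexive; ≤-refl; +-mono-≤; m≤m+n; m≤n+m; 1+n≰n; ≤⇒≤′; n≤1+n)
  open import Data.Bool using (Bool; true; false; _∧_; _∨_; not; if_then_else_)
  open import Data.Bool.Properties using (∨-assoc; ∨-identityʳ; ∨-zeroʳ; ∧-zeroʳ) renaming (_≟_ to _≟ᵇ_)
  open import Data.Fin using (Fin; zero; suc; splitAt; toℕ; _↑ˡ_; _↑ʳ_)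
  open import Data.Fin.Properties using (splitAt-↑ˡ; splitAt-↑ʳ; splitAt⁻¹-↑ˡ; splitAt⁻¹-↑ʳ; toℕ-↑ˡ; toℕ-↑ʳ; all?; ¬∀⟶∃¬)
  open import Data.Fin.Subset using (Subset; ⊥; Nonempty)
  open import Data.Vec using (_++_)
  open import Data.Vec.Properties using (lookup-++ˡ; lookup-++ʳ; lookup-replicate; []=⇒lookup)
  open import Data.List using (foldr; allFin; tabulate)
  open import Data.Bool.ListAction using (any)
  open import Data.Sum using (_⊎_; inj₁; inj₂)
  open import Data.Product using (_×_; _,_)
  open import Relation.Nullary using (yes; no; ¬_; contradiction)
  open import Relation.Binary.PropositionalEquality
  open import Function using (_∘_; id)

  -- Disjunctions and sums indexed by Fin n, by recursion on n.  The folds over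
  -- allFin n used in Defs are rewritten into these forms once and for all.

  anyF : (n : ℕ) → (Fin n → Bool) → Bool
  anyF zero    p = false
  anyF (suc n) p = p zero ∨ anyF n (p ∘ suc)

  sumF : (n : ℕ) → (Fin n → ℕ) → ℕ
  sumF zero    f = 0
  sumF (suc n) f = f zero + sumF n (f ∘ suc)

  ind : Bool → ℕ
  ind b = if b then 1 else 0

  any-tabulate : ∀ n {A : Set} (p : A → Bool) (g : Fin n → A) → any p (tabulate g) ≡ anyF n (p ∘ g)
  any-tabulate zero    p g = refl
  any-tabulate (suc n) p g = cong (p (g zero) ∨_) (any-tabulate n p (g ∘ suc))

  any-allFin : ∀ n (p : Fin n → Bool) → any p (allFin n) ≡ anyF n p
  any-allFin n p = any-tabulate n p id

  sum-tabulate : ∀ n {A : Set} (f : A → ℕ) (g : Fin n → A) →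
    foldr (λ v acc → f v + acc) 0 (tabulate g) ≡ sumF n (f ∘ g)
  sum-tabulate zero    f g = refl
  sum-tabulate (suc n) f g = cong (f (g zero) +_) (sum-tabulate n f (g ∘ suc))

  sum-allFin : ∀ n (f : Fin n → ℕ) → foldr (λ v acc → f v + acc) 0 (allFin n) ≡ sumF n f
  sum-allFin n f = sum-tabulate n f id

  anyF-cong : ∀ n {p q : Fin n → Bool} → (∀ i → p i ≡ q i) → anyF n p ≡ anyF n q
  anyF-cong zero    eq = refl
  anyF-cong (suc n) eq = cong₂ _∨_ (eq zero) (anyF-cong n (eq ∘ suc))

  sumF-cong : ∀ n {f g : Fin n → ℕ} → (∀ i → f i ≡ g i) → sumF n f ≡ sumF n g
  sumF-cong zero    eq = refl
  sumF-cong (suc n) eq = cong₂ _+_ (eq zero) (sumF-cong n (eq ∘ suc))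

  anyF-false : ∀ n {p : Fin n → Bool} → (∀ i → p i ≡ false) → anyF n p ≡ false
  anyF-false zero    all-false = refl
  anyF-false (suc n) all-false rewrite all-false zero = anyF-false n (all-false ∘ suc)

  sumF-zero : ∀ n {f : Fin n → ℕ} → (∀ i → f i ≡ 0) → sumF n f ≡ 0
  sumF-zero zero    all-zero = refl
  sumF-zero (suc n) all-zero rewrite all-zero zero = sumF-zero n (all-zero ∘ suc)

  anyF-witness : ∀ n {p : Fin n → Bool} (i : Fin n) → p i ≡ true → anyF n p ≡ true
  anyF-witness (suc n)     zero    pᵢ rewrite pᵢ = refl
  anyF-witness (suc n) {p} (suc i) pᵢ =
    trans (cong (p zero ∨_) (anyF-witness n i pᵢ)) (∨-zeroʳ (p zero))

  anyF-+ : ∀ s t (p : Fin (s + t) → Bool) →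
    anyF (s + t) p ≡ anyF s (λ a → p (a ↑ˡ t)) ∨ anyF t (λ b → p (s ↑ʳ b))
  anyF-+ zero    t p = refl
  anyF-+ (suc s) t p = trans (cong (p zero ∨_) (anyF-+ s t (p ∘ suc))) (sym (∨-assoc (p zero) _ _))

  sumF-+ : ∀ s t (f : Fin (s + t) → ℕ) →
    sumF (s + t) f ≡ sumF s (λ a → f (a ↑ˡ t)) + sumF t (λ b → f (s ↑ʳ b))
  sumF-+ zero    t f = refl
  sumF-+ (suc s) t f = trans (cong (f zero +_) (sumF-+ s t (f ∘ suc))) (sym (+-assoc (f zero) _ _))

  anyF-left : ∀ s t (p : Fin (s + t) → Bool) → (∀ b → p (s ↑ʳ b) ≡ false) →
    anyF (s + t) p ≡ anyF s (λ a → p (a ↑ˡ t))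
  anyF-left s t p right-false =
    trans (anyF-+ s t p)
      (trans (cong (anyF s (λ a → p (a ↑ˡ t)) ∨_) (anyF-false t right-false)) (∨-identityʳ _))

  anyF-right : ∀ s t (p : Fin (s + t) → Bool) → (∀ a → p (a ↑ˡ t) ≡ false) →
    anyF (s + t) p ≡ anyF t (λ b → p (s ↑ʳ b))
  anyF-right s t p left-false = trans (anyF-+ s t p) (cong (_∨ anyF t (λ b → p (s ↑ʳ b))) (anyF-false s left-false))

  sumF-left : ∀ s t (f : Fin (s + t) → ℕ) → (∀ b → f (s ↑ʳ b) ≡ 0) →
    sumF (s + t) f ≡ sumF s (λ a → f (a ↑ˡ t))
  sumF-left s t f right-zero =
    trans (sumF-+ s t f)
      (trans (cong (sumF s (λ a → f (a ↑ˡ t)) +_) (sumF-zero t right-zero)) (+-identityʳ _))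

  sumF-right : ∀ s t (f : Fin (s + t) → ℕ) → (∀ a → f (a ↑ˡ t) ≡ 0) →
    sumF (s + t) f ≡ sumF t (λ b → f (s ↑ʳ b))
  sumF-right s t f left-zero = trans (sumF-+ s t f) (cong (_+ sumF t (λ b → f (s ↑ʳ b))) (sumF-zero s left-zero))

  count-bound : ∀ n (p : Fin n → Bool) → sumF n (ind ∘ p) ≤ n
  count-bound zero    p = z≤n
  count-bound (suc n) p with p zero
  ... | true  = s≤s (count-bound n (p ∘ suc))
  ... | false = ≤-trans (count-bound n (p ∘ suc)) (n≤1+n n)

  ind-mono : ∀ {a b} → (a ≡ true → b ≡ true) → ind a ≤ ind b
  ind-mono {false} a⇒b = z≤n
  ind-mono {true}  a⇒b rewrite a⇒b refl = ≤-refl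

  count-mono : ∀ n (p q : Fin n → Bool) → (∀ i → p i ≡ true → q i ≡ true) →
    sumF n (ind ∘ p) ≤ sumF n (ind ∘ q)
  count-mono zero    p q p⇒q = z≤n
  count-mono (suc n) p q p⇒q =
    +-mono-≤ (ind-mono (p⇒q zero)) (count-mono n (p ∘ suc) (q ∘ suc) (p⇒q ∘ suc))

  count-strict : ∀ n (p q : Fin n → Bool) → (∀ i → p i ≡ true → q i ≡ true) →
    (i : Fin n) → p i ≡ false → q i ≡ true → suc (sumF n (ind ∘ p)) ≤ sumF n (ind ∘ q)
  count-strict (suc n) p q p⇒q zero    pᵢ qᵢ rewrite pᵢ | qᵢ =
    s≤s (count-mono n (p ∘ suc) (q ∘ suc) (p⇒q ∘ suc))
  count-strict (suc n) p q p⇒q (suc i) pᵢ qᵢ =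
    ≤-trans (≤-reflexive (sym (+-suc (ind (p zero)) _)))
      (+-mono-≤ (ind-mono (p⇒q zero)) (count-strict n (p ∘ suc) (q ∘ suc) (p⇒q ∘ suc) i pᵢ qᵢ))

  first : ∀ n → (Fin n → Bool) → Fin n → Bool
  first n p v = p v ∧ not (anyF n (λ u → (toℕ u <ᵇ toℕ v) ∧ p u))

  count-first : ∀ n (p : Fin n → Bool) → anyF n p ≡ true → sumF n (ind ∘ first n p) ≡ 1
  count-first (suc n) p nonempty with p zero
  ... | true  = cong₂ _+_ (cong (ind ∘ not) (anyF-false n (λ _ → refl)))
                          (sumF-zero n (λ v → cong ind (∧-zeroʳ _)))
  ... | false = count-first n (p ∘ suc) nonempty

  ≡ᵇ-refl : ∀ m → (m ≡ᵇ m) ≡ true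
  ≡ᵇ-refl zero    = refl
  ≡ᵇ-refl (suc m) = ≡ᵇ-refl m

  ≡ᵇ-shift : ∀ k a b → ((k + a) ≡ᵇ (k + b)) ≡ (a ≡ᵇ b)
  ≡ᵇ-shift zero    a b = refl
  ≡ᵇ-shift (suc k) a b = ≡ᵇ-shift k a b

  <ᵇ-shift : ∀ k a b → ((k + a) <ᵇ (k + b)) ≡ (a <ᵇ b)
  <ᵇ-shift zero    a b = refl
  <ᵇ-shift (suc k) a b = <ᵇ-shift k a b

  module Reach {n : ℕ} (G : Graph n) (X : Subset n) where

    reach-suc : ∀ j u v → reach G X (suc j) u v
      ≡ reach G X j u v ∨ anyF n (λ w → reach G X j u w ∧ adj G w v ∧ (v ∈ᵇ X))
    reach-suc j u v = cong (reach G X j u v ∨_) (any-allFin n _)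

    reach-target-outside : ∀ j u v → v ∈ᵇ X ≡ false → reach G X j u v ≡ false
    reach-target-outside zero    u v v∉X rewrite v∉X = ∧-zeroʳ (u ∈ᵇ X)
    reach-target-outside (suc j) u v v∉X rewrite reach-suc j u v | reach-target-outside j u v v∉X | v∉X =
      anyF-false n (λ w → trans (cong (reach G X j u w ∧_) (∧-zeroʳ (adj G w v))) (∧-zeroʳ _))

    reach-source-outside : ∀ j u v → u ∈ᵇ X ≡ false → reach G X j u v ≡ false
    reach-source-outside zero    u v u∉X rewrite u∉X = refl
    reach-source-outside (suc j) u v u∉X rewrite reach-suc j u v | reach-source-outside j u v u∉X =
      anyF-false n (λ w → cong (λ r → r ∧ adj G w v ∧ (v ∈ᵇ X)) (reach-source-outside j u w u∉X))

    reach-start : ∀ u → u ∈ᵇ X ≡ true → reach G X 0 u u ≡ true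
    reach-start u u∈X rewrite u∈X = ≡ᵇ-refl (toℕ u)

    reach-step : ∀ j u w v → reach G X j u w ≡ true → adj G w v ≡ true → v ∈ᵇ X ≡ true →
      reach G X (suc j) u v ≡ true
    reach-step j u w v uw wv v∈X rewrite reach-suc j u v =
      trans (cong (reach G X j u v ∨_)
              (anyF-witness n w (trans (cong₂ (λ r e → r ∧ e ∧ (v ∈ᵇ X)) uw wv) v∈X)))
            (∨-zeroʳ _)

    reach-grow : ∀ j u v → reach G X j u v ≡ true → reach G X (suc j) u v ≡ true
    reach-grow j u v uv rewrite uv = refl

    reach-mono : ∀ {j k} u v → j ≤ k → reach G X j u v ≡ true → reach G X k u v ≡ true
    reach-mono u v j≤k = go (≤⇒≤′ j≤k)
      where
      go : ∀ {j k} → j ≤′ k → reach G X j u v ≡ true → reach G X k u v ≡ true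
      go ≤′-refl                     uv = uv
      go {k = suc k} (≤′-step j≤k) uv = reach-grow k u v (go j≤k uv)

    reach-two-via : ∀ u w v → u ∈ᵇ X ≡ true → adj G u w ≡ true → w ∈ᵇ X ≡ true →
      adj G w v ≡ true → v ∈ᵇ X ≡ true → reach G X 2 u v ≡ true
    reach-two-via u w v u∈X uw w∈X wv v∈X =
      reach-step 1 u w v (reach-step 0 u u w (reach-start u u∈X) uw w∈X) wv v∈X

    reach-two-edge : ∀ u v → u ∈ᵇ X ≡ true → adj G u v ≡ true → v ∈ᵇ X ≡ true →
      reach G X 2 u v ≡ true
    reach-two-edge u v u∈X uv v∈X = reach-grow 1 u v (reach-step 0 u u v (reach-start u u∈X) uv v∈X)

    -- Saturation: the set of vertices reachable from u grows with j until it
    -- stops changing, and it can grow at most n times; so walks with more than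
    -- n edges reach nothing new and `connected` (walks of length ≤ n) is exact.
    module Saturation (u : Fin n) where

      Stable : ℕ → Set
      Stable j = ∀ v → reach G X (suc j) u v ≡ reach G X j u v

      stable? : ∀ j → Stable j ⊎ ¬ Stable j
      stable? j with all? (λ v → reach G X (suc j) u v ≟ᵇ reach G X j u v)
      ... | yes st = inj₁ st
      ... | no ¬st = inj₂ ¬st

      stable-suc : ∀ j → Stable j → Stable (suc j)
      stable-suc j st v = begin
        reach G X (suc (suc j)) u v
          ≡⟨ reach-suc (suc j) u v ⟩
        reach G X (suc j) u v ∨ anyF n (λ w → reach G X (suc j) u w ∧ adj G w v ∧ (v ∈ᵇ X))
          ≡⟨ cong₂ _∨_ (st v) (anyF-cong n (λ w → cong (λ r → r ∧ adj G w v ∧ (v ∈ᵇ X)) (st w))) ⟩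
        reach G X j u v ∨ anyF n (λ w → reach G X j u w ∧ adj G w v ∧ (v ∈ᵇ X))
          ≡⟨ reach-suc j u v ⟨
        reach G X (suc j) u v ∎
        where open ≡-Reasoning

      reached : ℕ → ℕ
      reached j = sumF n (ind ∘ reach G X j u)

      newly-reached : ∀ {a b} → (a ≡ true → b ≡ true) → ¬ (b ≡ a) → (a ≡ false) × (b ≡ true)
      newly-reached {false} {true}  _   _       = refl , refl
      newly-reached {false} {false} _   changed = contradiction refl changed
      newly-reached {true}  {true}  _   changed = contradiction refl changed
      newly-reached {true}  {false} a⇒b _       = contradiction (a⇒b refl) (λ ())

      growth : ∀ j → ¬ Stable j → suc (reached j) ≤ reached (suc j)
      growth j ¬st with ¬∀⟶∃¬ n _ (λ v → reach G X (suc j) u v ≟ᵇ reach G X j u v) ¬st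
      ... | v , changed with newly-reached (reach-grow j u v) changed
      ...   | old , now = count-strict n _ _ (reach-grow j u) v old now

      stable-or-growing : ∀ j → Stable j ⊎ suc j ≤ reached (suc j)
      stable-or-growing zero with stable? zero
      ... | inj₁ st  = inj₁ st
      ... | inj₂ ¬st = inj₂ (≤-trans (s≤s z≤n) (growth zero ¬st))
      stable-or-growing (suc j) with stable-or-growing j
      ... | inj₁ st    = inj₁ (stable-suc j st)
      ... | inj₂ large with stable? (suc j)
      ...   | inj₁ st  = inj₁ st
      ...   | inj₂ ¬st = inj₂ (≤-trans (s≤s large) (growth (suc j) ¬st))

      stable-n : Stable n
      stable-n with stable-or-growing n
      ... | inj₁ st    = st
      ... | inj₂ large = contradiction (≤-trans large (count-bound n _)) 1+n≰n

      saturated : ∀ {j} v → n ≤ j → reach G X j u v ≡ connected G X u v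
      saturated v n≤j = go (≤⇒≤′ n≤j)
        where
        go : ∀ {j} → n ≤′ j → reach G X j u v ≡ reach G X n u v
        stable-beyond : ∀ {j} → n ≤′ j → Stable j
        go ≤′-refl       = refl
        go (≤′-step n≤j) = trans (stable-beyond n≤j v) (go n≤j)
        stable-beyond ≤′-refl                 = stable-n
        stable-beyond {suc j} (≤′-step n≤j) = stable-suc j (stable-beyond n≤j)

    reach-saturated : ∀ {j} u v → n ≤ j → reach G X j u v ≡ connected G X u v
    reach-saturated u = Saturation.saturated u

  leader : ∀ {n} → Graph n → Subset n → Fin n → Bool
  leader {n} G X v = (v ∈ᵇ X) ∧ not (anyF n (λ u → (toℕ u <ᵇ toℕ v) ∧ connected G X u v))

  components-leaders : ∀ {n} (G : Graph n) X → components G X ≡ sumF n (ind ∘ leader G X)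
  components-leaders {n} G X =
    trans (sum-allFin n _) (sumF-cong n (λ v → cong (λ b → ind ((v ∈ᵇ X) ∧ not b)) (any-allFin n _)))

  leader-outside : ∀ {n} (G : Graph n) X v → v ∈ᵇ X ≡ false → leader G X v ≡ false
  leader-outside G X v v∉X rewrite v∉X = refl

  components-empty : ∀ {n} (G : Graph n) → components G ⊥ ≡ 0
  components-empty {n} G = trans (components-leaders G ⊥)
    (sumF-zero n (λ v → cong ind (leader-outside G ⊥ v (lookup-replicate v false))))

  -- A nonempty connected G[X] has exactly one component: connectedness makes
  -- the leaders exactly the first vertex of X.
  components-connected : ∀ {n} (G : Graph n) X (a : Fin n) → a ∈ᵇ X ≡ true →
    (∀ u v → u ∈ᵇ X ≡ true → v ∈ᵇ X ≡ true → connected G X u v ≡ true) → components G X ≡ 1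
  components-connected {n} G X a a∈X conn = begin
    components G X                  ≡⟨ components-leaders G X ⟩
    sumF n (ind ∘ leader G X)       ≡⟨ sumF-cong n (cong ind ∘ leader-is-first) ⟩
    sumF n (ind ∘ first n (_∈ᵇ X))  ≡⟨ count-first n (_∈ᵇ X) (anyF-witness n a a∈X) ⟩
    1                               ∎
    where
    open ≡-Reasoning

    connected-to : ∀ v → v ∈ᵇ X ≡ true → ∀ u → connected G X u v ≡ u ∈ᵇ X
    connected-to v v∈X u with u ∈ᵇ X in u∈X
    ... | true  = conn u v u∈X v∈X
    ... | false = Reach.reach-source-outside G X n u v u∈X

    leader-is-first : ∀ v → leader G X v ≡ first n (_∈ᵇ X) v
    leader-is-first v with v ∈ᵇ X in v∈X
    ... | false = refl
    ... | true  = cong not (anyF-cong n (λ u → cong ((toℕ u <ᵇ toℕ v) ∧_) (connected-to v v∈X u)))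

  -- G'[Z] is a copy of G[X] translated by a fixed offset: `embed` preserves
  -- adjacency and membership and shifts indices uniformly, and Z has no vertex
  -- outside the copy, so disjunctions and sums of functions vanishing off Z
  -- may be taken over the copy only.
  record Copy {m n} (G : Graph m) (X : Subset m) (G' : Graph n) (Z : Subset n) : Set where
    field
      embed    : Fin m → Fin n
      offset   : ℕ
      shifted  : ∀ a → toℕ (embed a) ≡ offset + toℕ a
      member   : ∀ a → embed a ∈ᵇ Z ≡ a ∈ᵇ X
      adjacent : ∀ a b → adj G' (embed a) (embed b) ≡ adj G a b
      any-copy : ∀ p → (∀ w → w ∈ᵇ Z ≡ false → p w ≡ false) → anyF n p ≡ anyF m (p ∘ embed)
      sum-copy : ∀ f → (∀ w → w ∈ᵇ Z ≡ false → f w ≡ 0) → sumF n f ≡ sumF m (f ∘ embed)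
      smaller  : m ≤ n

  module _ {m n} {G : Graph m} {X : Subset m} {G' : Graph n} {Z : Subset n} (copy : Copy G X G' Z) where
    open Copy copy
    open ≡-Reasoning

    reach-copy : ∀ j a b → reach G' Z j (embed a) (embed b) ≡ reach G X j a b
    reach-copy zero a b = cong₂ _∧_ (member a) (cong₂ _∧_ (member b) same-index)
      where
      same-index : (toℕ (embed a) ≡ᵇ toℕ (embed b)) ≡ (toℕ a ≡ᵇ toℕ b)
      same-index = trans (cong₂ _≡ᵇ_ (shifted a) (shifted b)) (≡ᵇ-shift offset (toℕ a) (toℕ b))
    reach-copy (suc j) a b = begin
      reach G' Z (suc j) (embed a) (embed b)
        ≡⟨ Reach.reach-suc G' Z j (embed a) (embed b) ⟩
      reach G' Z j (embed a) (embed b) ∨ anyF n (extend G' Z (embed a) (embed b))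
        ≡⟨ cong (reach G' Z j (embed a) (embed b) ∨_) (any-copy _ extend-outside) ⟩
      reach G' Z j (embed a) (embed b) ∨ anyF m (extend G' Z (embed a) (embed b) ∘ embed)
        ≡⟨ cong₂ _∨_ (reach-copy j a b) (anyF-cong m (λ c →
             cong₂ _∧_ (reach-copy j a c) (cong₂ _∧_ (adjacent c b) (member b)))) ⟩
      reach G X j a b ∨ anyF m (extend G X a b)
        ≡⟨ Reach.reach-suc G X j a b ⟨
      reach G X (suc j) a b ∎
      where
      extend : ∀ {k} → Graph k → Subset k → Fin k → Fin k → Fin k → Bool
      extend H Y u v w = reach H Y j u w ∧ adj H w v ∧ (v ∈ᵇ Y)

      extend-outside : ∀ w → w ∈ᵇ Z ≡ false → extend G' Z (embed a) (embed b) w ≡ false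
      extend-outside w w∉Z =
        cong (_∧ adj G' w (embed b) ∧ (embed b ∈ᵇ Z)) (Reach.reach-target-outside G' Z j (embed a) w w∉Z)

    connected-copy : ∀ a b → connected G' Z (embed a) (embed b) ≡ connected G X a b
    connected-copy a b = trans (reach-copy n a b) (Reach.reach-saturated G X a b smaller)

    leader-copy : ∀ a → leader G' Z (embed a) ≡ leader G X a
    leader-copy a = cong₂ (λ inside earlier → inside ∧ not earlier) (member a) (begin
      anyF n (λ u → (toℕ u <ᵇ toℕ (embed a)) ∧ connected G' Z u (embed a))
        ≡⟨ any-copy _ (λ w w∉Z → trans (cong ((toℕ w <ᵇ toℕ (embed a)) ∧_)
             (Reach.reach-source-outside G' Z n w (embed a) w∉Z)) (∧-zeroʳ _)) ⟩
      anyF m (λ c → (toℕ (embed c) <ᵇ toℕ (embed a)) ∧ connected G' Z (embed c) (embed a))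
        ≡⟨ anyF-cong m (λ c → cong₂ _∧_ (before c) (connected-copy c a)) ⟩
      anyF m (λ c → (toℕ c <ᵇ toℕ a) ∧ connected G X c a) ∎)
      where
      before : ∀ c → (toℕ (embed c) <ᵇ toℕ (embed a)) ≡ (toℕ c <ᵇ toℕ a)
      before c = trans (cong₂ _<ᵇ_ (shifted c) (shifted a)) (<ᵇ-shift offset (toℕ c) (toℕ a))

    components-copy : components G' Z ≡ components G X
    components-copy = begin
      components G' Z                     ≡⟨ components-leaders G' Z ⟩
      sumF n (ind ∘ leader G' Z)          ≡⟨ sum-copy _ (λ w w∉Z → cong ind (leader-outside G' Z w w∉Z)) ⟩
      sumF m (ind ∘ leader G' Z ∘ embed)  ≡⟨ sumF-cong m (cong ind ∘ leader-copy) ⟩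
      sumF m (ind ∘ leader G X)           ≡⟨ components-leaders G X ⟨
      components G X                      ∎

  data Block (s t : ℕ) : Fin (s + t) → Set where
    left  : (a : Fin s) → Block s t (a ↑ˡ t)
    right : (b : Fin t) → Block s t (s ↑ʳ b)

  block : ∀ s t (u : Fin (s + t)) → Block s t u
  block s t u with splitAt s u in eq
  ... | inj₁ a = subst (Block s t) (splitAt⁻¹-↑ˡ eq) (left a)
  ... | inj₂ b = subst (Block s t) (splitAt⁻¹-↑ʳ eq) (right b)

  two-blocks : ∀ {s t} → Fin s → Fin t → 2 ≤ s + t
  two-blocks {suc s} {suc t} _ _ = s≤s (≤-trans (s≤s z≤n) (m≤n+m (suc t) s))

  module Join {s t : ℕ} (G : Graph s) (H : Graph t) where

    open Reach using (reach-two-via; reach-two-edge; reach-mono)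

    join-left : ∀ a b → adj (G ⋁ H) (a ↑ˡ t) (b ↑ˡ t) ≡ adj G a b
    join-left a b rewrite splitAt-↑ˡ s a t | splitAt-↑ˡ s b t = refl

    join-right : ∀ a b → adj (G ⋁ H) (s ↑ʳ a) (s ↑ʳ b) ≡ adj H a b
    join-right a b rewrite splitAt-↑ʳ s t a | splitAt-↑ʳ s t b = refl

    join-across : ∀ a b → adj (G ⋁ H) (a ↑ˡ t) (s ↑ʳ b) ≡ true
    join-across a b rewrite splitAt-↑ˡ s a t | splitAt-↑ʳ s t b = refl

    join-back : ∀ a b → adj (G ⋁ H) (s ↑ʳ b) (a ↑ˡ t) ≡ true
    join-back a b rewrite splitAt-↑ˡ s a t | splitAt-↑ʳ s t b = refl

    left-copy : ∀ X → Copy G X (G ⋁ H) (X ++ ⊥)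
    left-copy X = record
      { embed    = _↑ˡ t
      ; offset   = 0
      ; shifted  = λ a → toℕ-↑ˡ a t
      ; member   = lookup-++ˡ X ⊥
      ; adjacent = join-left
      ; any-copy = λ p off → anyF-left s t p (λ b → off (s ↑ʳ b) (right-outside b))
      ; sum-copy = λ f off → sumF-left s t f (λ b → off (s ↑ʳ b) (right-outside b))
      ; smaller  = m≤m+n s t
      }
      where
      right-outside : ∀ b → (s ↑ʳ b) ∈ᵇ (X ++ ⊥) ≡ false
      right-outside b = trans (lookup-++ʳ X ⊥ b) (lookup-replicate b false)

    right-copy : ∀ Y → Copy H Y (G ⋁ H) (⊥ ++ Y)
    right-copy Y = record
      { embed    = s ↑ʳ_
      ; offset   = s
      ; shifted  = toℕ-↑ʳ s
      ; member   = lookup-++ʳ (⊥ {s}) Y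
      ; adjacent = join-right
      ; any-copy = λ p off → anyF-right s t p (λ a → off (a ↑ˡ t) (left-outside a))
      ; sum-copy = λ f off → sumF-right s t f (λ a → off (a ↑ˡ t) (left-outside a))
      ; smaller  = m≤n+m t s
      }
      where
      left-outside : ∀ a → (a ↑ˡ t) ∈ᵇ (⊥ ++ Y) ≡ false
      left-outside a = trans (lookup-++ˡ ⊥ Y a) (lookup-replicate a false)

    components-left : ∀ X → components (G ⋁ H) (X ++ ⊥) ≡ components G X
    components-left X = components-copy (left-copy X)

    components-right : ∀ Y → components (G ⋁ H) (⊥ ++ Y) ≡ components H Y
    components-right Y = components-copy (right-copy Y)

    -- If X ∋ a and Y ∋ b, any two vertices of X ++ Y are joined by a walk of
    -- length at most two, crossing to the other block if necessary.
    within-two : ∀ X Y a b → a ∈ᵇ X ≡ true → b ∈ᵇ Y ≡ true →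
      ∀ (u v : Fin (s + t)) → u ∈ᵇ (X ++ Y) ≡ true → v ∈ᵇ (X ++ Y) ≡ true →
      reach (G ⋁ H) (X ++ Y) 2 u v ≡ true
    within-two X Y a b a∈X b∈Y u v u∈Z v∈Z with block s t u | block s t v
    ... | left a′  | left b′  = reach-two-via (G ⋁ H) (X ++ Y) _ (s ↑ʳ b) _ u∈Z (join-across a′ b)
                                  (trans (lookup-++ʳ X Y b) b∈Y) (join-back b′ b) v∈Z
    ... | right a′ | right b′ = reach-two-via (G ⋁ H) (X ++ Y) _ (a ↑ˡ t) _ u∈Z (join-back a a′)
                                  (trans (lookup-++ˡ X Y a) a∈X) (join-across a b′) v∈Z
    ... | left a′  | right b′ = reach-two-edge (G ⋁ H) (X ++ Y) _ _ u∈Z (join-across a′ b′) v∈Z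
    ... | right a′ | left b′  = reach-two-edge (G ⋁ H) (X ++ Y) _ _ u∈Z (join-back b′ a′) v∈Z

    components-both : ∀ X Y → Nonempty X → Nonempty Y → components (G ⋁ H) (X ++ Y) ≡ 1
    components-both X Y (a , a∈X) (b , b∈Y) =
      components-connected (G ⋁ H) (X ++ Y) (a ↑ˡ t) (trans (lookup-++ˡ X Y a) ([]=⇒lookup a∈X))
        (λ u v u∈Z v∈Z → reach-mono (G ⋁ H) (X ++ Y) u v (two-blocks a b)
          (within-two X Y a b ([]=⇒lookup a∈X) ([]=⇒lookup b∈Y) u v u∈Z v∈Z))

module Polynomials {c ℓ : Level} (R : CommutativeRing c ℓ) where

  open import Data.Nat as ℕ using (zero; suc)
  open import Data.Nat.Properties using () renaming (+-identityʳ to ℕ-+-identityʳ)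
  open import Data.Bool using (true; false)
  open import Data.Fin using (zero; suc)
  open import Data.Fin.Subset using (Subset; ∣_∣; ⊥; Nonempty)
  open import Data.Fin.Subset.Properties using (∣⊥∣≡0)
  open import Data.Vec using ([]; _∷_; _++_; here; there)
  open import Data.List using (List; []; _∷_; foldr; map) renaming (_++_ to _++ᴸ_)
  open import Data.Product using (_,_)
  open import Relation.Binary.PropositionalEquality as ≡ using (_≡_)
  open import Function using (_∘_)
  open CommutativeRing R hiding (zero)
  open Poly R
  open import Relation.Binary.Reasoning.Setoid setoid
  open import Algebra.Properties.CommutativeSemigroup +-commutativeSemigroup using (interchange)

  sumList : ∀ {n} → List (Subset n) → (Subset n → Carrier) → Carrier
  sumList L g = foldr (λ X acc → g X + acc) 0# L

  sumList-++ : ∀ {n} (L M : List (Subset n)) g → sumList (L ++ᴸ M) g ≈ sumList L g + sumList M g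
  sumList-++ []      M g = sym (+-identityˡ _)
  sumList-++ (X ∷ L) M g = trans (+-congˡ (sumList-++ L M g)) (sym (+-assoc _ _ _))

  sumList-map : ∀ {m n} (h : Subset m → Subset n) L g → sumList (map h L) g ≡ sumList L (g ∘ h)
  sumList-map h []      g = ≡.refl
  sumList-map h (X ∷ L) g = ≡.cong (g (h X) +_) (sumList-map h L g)

  sumList-cong : ∀ {n} (L : List (Subset n)) {g g′} → (∀ X → g X ≈ g′ X) → sumList L g ≈ sumList L g′
  sumList-cong []      eq = refl
  sumList-cong (X ∷ L) eq = +-cong (eq X) (sumList-cong L eq)

  sumList-+ : ∀ {n} (L : List (Subset n)) g h → sumList L (λ X → g X + h X) ≈ sumList L g + sumList L h
  sumList-+ []      g h = sym (+-identityʳ _)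
  sumList-+ (X ∷ L) g h = trans (+-congˡ (sumList-+ L g h)) (interchange _ _ _ _)

  sumList-scale : ∀ {n} (L : List (Subset n)) a g → sumList L (λ X → a * g X) ≈ a * sumList L g
  sumList-scale []      a g = sym (zeroʳ a)
  sumList-scale (X ∷ L) a g = trans (+-congˡ (sumList-scale L a g)) (sym (distribˡ a _ _))

  Σ⊆ : ∀ n → (Subset n → Carrier) → Carrier
  Σ⊆ n = sumList (allSubsets n)

  Σ⊆-suc : ∀ n g → Σ⊆ (suc n) g ≈ Σ⊆ n (g ∘ (false ∷_)) + Σ⊆ n (g ∘ (true ∷_))
  Σ⊆-suc n g = trans (sumList-++ (map (false ∷_) (allSubsets n)) _ g)
    (+-cong (reflexive (sumList-map (false ∷_) (allSubsets n) g))
            (reflexive (sumList-map (true ∷_) (allSubsets n) g)))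

  Σ⊆-++ : ∀ s t g → Σ⊆ (s ℕ.+ t) g ≈ Σ⊆ s (λ X → Σ⊆ t (λ Y → g (X ++ Y)))
  Σ⊆-++ zero    t g = sym (+-identityʳ _)
  Σ⊆-++ (suc s) t g = begin
    Σ⊆ (suc s ℕ.+ t) g
      ≈⟨ Σ⊆-suc (s ℕ.+ t) g ⟩
    Σ⊆ (s ℕ.+ t) (g ∘ (false ∷_)) + Σ⊆ (s ℕ.+ t) (g ∘ (true ∷_))
      ≈⟨ +-cong (Σ⊆-++ s t _) (Σ⊆-++ s t _) ⟩
    Σ⊆ s (λ X → Σ⊆ t (λ Y → g (false ∷ X ++ Y))) + Σ⊆ s (λ X → Σ⊆ t (λ Y → g (true ∷ X ++ Y)))
      ≈⟨ Σ⊆-suc s _ ⟨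
    Σ⊆ (suc s) (λ X → Σ⊆ t (λ Y → g (X ++ Y))) ∎

  -- the sum over the nonempty subsets
  Σ⁺ : ∀ n → (Subset n → Carrier) → Carrier
  Σ⁺ zero    g = 0#
  Σ⁺ (suc n) g = Σ⁺ n (g ∘ (false ∷_)) + Σ⊆ n (g ∘ (true ∷_))

  Σ⊆-split : ∀ n g → Σ⊆ n g ≈ g ⊥ + Σ⁺ n g
  Σ⊆-split zero    g = refl
  Σ⊆-split (suc n) g =
    trans (Σ⊆-suc n g) (trans (+-congʳ (Σ⊆-split n (g ∘ (false ∷_)))) (+-assoc _ _ _))

  Σ⁺-cong : ∀ n {g g′} → (∀ X → Nonempty X → g X ≈ g′ X) → Σ⁺ n g ≈ Σ⁺ n g′
  Σ⁺-cong zero    eq = refl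
  Σ⁺-cong (suc n) eq = +-cong (Σ⁺-cong n (λ X (i , i∈X) → eq (false ∷ X) (suc i , there i∈X)))
                              (sumList-cong (allSubsets n) (λ X → eq (true ∷ X) (zero , here)))

  Σ⁺-scale : ∀ n a g → Σ⁺ n (λ X → a * g X) ≈ a * Σ⁺ n g
  Σ⁺-scale zero    a g = sym (zeroʳ a)
  Σ⁺-scale (suc n) a g =
    trans (+-cong (Σ⁺-scale n a _) (sumList-scale (allSubsets n) a _)) (sym (distribˡ a _ _))

  Σ⁺-scaleʳ : ∀ n a g → Σ⁺ n (λ X → g X * a) ≈ Σ⁺ n g * a
  Σ⁺-scaleʳ n a g =
    trans (Σ⁺-cong n (λ X _ → *-comm (g X) a)) (trans (Σ⁺-scale n a g) (*-comm a _))

  pow-+ : ∀ a i j → pow a (i ℕ.+ j) ≈ pow a i * pow a j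
  pow-+ a zero    j = sym (*-identityˡ _)
  pow-+ a (suc i) j = trans (*-congˡ (pow-+ a i j)) (sym (*-assoc _ _ _))

  binomial : ∀ x n → Σ⊆ n (λ X → pow x ∣ X ∣) ≈ pow (1# + x) n
  binomial x zero    = +-identityʳ _
  binomial x (suc n) = begin
    Σ⊆ (suc n) (λ X → pow x ∣ X ∣)
      ≈⟨ Σ⊆-suc n _ ⟩
    Σ⊆ n (λ X → pow x ∣ X ∣) + Σ⊆ n (λ X → x * pow x ∣ X ∣)
      ≈⟨ +-congˡ (sumList-scale (allSubsets n) x _) ⟩
    Σ⊆ n (λ X → pow x ∣ X ∣) + x * Σ⊆ n (λ X → pow x ∣ X ∣)
      ≈⟨ +-congʳ (sym (*-identityˡ _)) ⟩
    1# * Σ⊆ n (λ X → pow x ∣ X ∣) + x * Σ⊆ n (λ X → pow x ∣ X ∣)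
      ≈⟨ distribʳ _ 1# x ⟨
    (1# + x) * Σ⊆ n (λ X → pow x ∣ X ∣)
      ≈⟨ *-congˡ (binomial x n) ⟩
    pow (1# + x) (suc n) ∎

  card-++ : ∀ {m n} (X : Subset m) (Y : Subset n) → ∣ X ++ Y ∣ ≡ ∣ X ∣ ℕ.+ ∣ Y ∣
  card-++ []          Y = ≡.refl
  card-++ (true ∷ X)  Y = ≡.cong suc (card-++ X Y)
  card-++ (false ∷ X) Y = card-++ X Y

  rearrange : ∀ q h p p′ y → q + (h + p * (y * p′))
    ≈ q + (1# + h) + ((1# + p) - 1#) * ((1# + p′) - 1#) * y - 1#
  rearrange q h p p′ y = sym (begin
    q + (1# + h) + ((1# + p) - 1#) * ((1# + p′) - 1#) * y - 1#
      ≈⟨ +-congʳ (+-congˡ (*-congʳ (*-cong (cancel p) (cancel p′)))) ⟩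
    q + (1# + h) + p * p′ * y - 1#
      ≈⟨ +-congʳ (solve 4 (λ q o h c → (q ⊕ (o ⊕ h)) ⊕ c ⊜ (q ⊕ (h ⊕ c)) ⊕ o) refl q 1# h (p * p′ * y)) ⟩
    q + (h + p * p′ * y) + 1# - 1#
      ≈⟨ //-rightDividesʳ 1# _ ⟩
    q + (h + p * p′ * y)
      ≈⟨ +-congˡ (+-congˡ (trans (*-assoc p p′ y) (*-congˡ (*-comm p′ y)))) ⟩
    q + (h + p * (y * p′)) ∎)
    where
    open import Algebra.Solver.CommutativeMonoid +-commutativeMonoid using (solve; _⊕_; _⊜_)
    open import Algebra.Properties.Group +-group using (//-rightDividesʳ)

    cancel : ∀ a → (1# + a) - 1# ≈ a
    cancel a = trans (+-congʳ (+-comm 1# a)) (//-rightDividesʳ 1# a)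

  module Join {s t} (G : Graph s) (H : Graph t) (x y : Carrier) where
    open Components.Join G H using (components-left; components-right; components-both)

    weight : ∀ {n} → Graph n → Subset n → Carrier
    weight K X = pow x ∣ X ∣ * pow y (components K X)

    xpow : ∀ {n} → Subset n → Carrier
    xpow X = pow x ∣ X ∣

    size-left : ∀ {n} (X : Subset n) → ∣ X ++ ⊥ {t} ∣ ≡ ∣ X ∣
    size-left X = ≡.trans (card-++ X ⊥) (≡.trans (≡.cong (∣ X ∣ ℕ.+_) (∣⊥∣≡0 t)) (ℕ-+-identityʳ _))

    weight-left : ∀ X → weight (G ⋁ H) (X ++ ⊥) ≈ weight G X
    weight-left X = reflexive (≡.cong₂ (λ i k → pow x i * pow y k) (size-left X) (components-left X))

    weight-right : ∀ Y → weight (G ⋁ H) (⊥ ++ Y) ≈ weight H Y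
    weight-right Y = reflexive (≡.cong₂ (λ i k → pow x i * pow y k)
      (≡.trans (card-++ (⊥ {s}) Y) (≡.cong (ℕ._+ ∣ Y ∣) (∣⊥∣≡0 s))) (components-right Y))

    weight-both : ∀ X Y → Nonempty X → Nonempty Y → weight (G ⋁ H) (X ++ Y) ≈ xpow X * (y * xpow Y)
    weight-both X Y X≠∅ Y≠∅ = begin
      pow x ∣ X ++ Y ∣ * pow y (components (G ⋁ H) (X ++ Y))
        ≈⟨ reflexive (≡.cong₂ (λ i k → pow x i * pow y k) (card-++ X Y) (components-both X Y X≠∅ Y≠∅)) ⟩
      pow x (∣ X ∣ ℕ.+ ∣ Y ∣) * (y * 1#)
        ≈⟨ *-cong (pow-+ x ∣ X ∣ ∣ Y ∣) (*-identityʳ y) ⟩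
      xpow X * xpow Y * y
        ≈⟨ *-assoc _ _ _ ⟩
      xpow X * (xpow Y * y)
        ≈⟨ *-congˡ (*-comm _ y) ⟩
      xpow X * (y * xpow Y) ∎

    weight-empty : ∀ {n} (K : Graph n) → weight K ⊥ ≈ 1#
    weight-empty {n} K =
      trans (reflexive (≡.cong₂ (λ i k → pow x i * pow y k) (∣⊥∣≡0 n) (Components.components-empty K)))
            (*-identityʳ 1#)

    Q-split : ∀ {n} (K : Graph n) → Q K x y ≈ 1# + Σ⁺ n (weight K)
    Q-split {n} K = trans (Σ⊆-split n (weight K)) (+-congʳ (weight-empty K))

    binomial-split : ∀ n → pow (1# + x) n ≈ 1# + Σ⁺ n xpow
    binomial-split n = trans (sym (binomial x n)) (trans (Σ⊆-split n xpow)
      (+-congʳ (reflexive (≡.cong (pow x) (∣⊥∣≡0 n)))))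

    Q-join : Q (G ⋁ H) x y ≈ Q G x y + (Σ⁺ t (weight H) + Σ⁺ s xpow * (y * Σ⁺ t xpow))
    Q-join = begin
      Σ⊆ (s ℕ.+ t) (weight (G ⋁ H))
        ≈⟨ Σ⊆-++ s t _ ⟩
      Σ⊆ s (λ X → Σ⊆ t (λ Y → weight (G ⋁ H) (X ++ Y)))
        ≈⟨ sumList-cong (allSubsets s) (λ X → Σ⊆-split t _) ⟩
      Σ⊆ s (λ X → weight (G ⋁ H) (X ++ ⊥) + Σ⁺ t (λ Y → weight (G ⋁ H) (X ++ Y)))
        ≈⟨ sumList-+ (allSubsets s) _ _ ⟩
      Σ⊆ s (λ X → weight (G ⋁ H) (X ++ ⊥)) + Σ⊆ s (λ X → Σ⁺ t (λ Y → weight (G ⋁ H) (X ++ Y)))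
        ≈⟨ +-cong (sumList-cong (allSubsets s) weight-left) (Σ⊆-split s _) ⟩
      Q G x y + (Σ⁺ t (λ Y → weight (G ⋁ H) (⊥ ++ Y)) + Σ⁺ s (λ X → Σ⁺ t (λ Y → weight (G ⋁ H) (X ++ Y))))
        ≈⟨ +-congˡ (+-cong (Σ⁺-cong t (λ Y _ → weight-right Y)) (Σ⁺-cong s (λ X X≠∅ →
             trans (Σ⁺-cong t (λ Y → weight-both X Y X≠∅)) (Σ⁺-scale t (xpow X) _)))) ⟩
      Q G x y + (Σ⁺ t (weight H) + Σ⁺ s (λ X → xpow X * Σ⁺ t (λ Y → y * xpow Y)))
        ≈⟨ +-congˡ (+-congˡ (trans (Σ⁺-cong s (λ X _ → *-congˡ (Σ⁺-scale t y xpow))) (Σ⁺-scaleʳ s _ xpow))) ⟩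
      Q G x y + (Σ⁺ t (weight H) + Σ⁺ s xpow * (y * Σ⁺ t xpow)) ∎

theorem5p7 : {c ℓ : Level} (R : CommutativeRing c ℓ) (s t : ℕ) (G : Graph s) (H : Graph t)
      (x y : CommutativeRing.Carrier R) →
      let open CommutativeRing R
          open Poly R
      in Q (G ⋁ H) x y ≈ Q G x y + Q H x y + (pow (1# + x) s - 1#) * (pow (1# + x) t - 1#) * y - 1#
theorem5p7 R s t G H x y = begin
  Q (G ⋁ H) x y
    ≈⟨ Q-join ⟩
  Q G x y + (Σ⁺ t (weight H) + Σ⁺ s xpow * (y * Σ⁺ t xpow))
    ≈⟨ rearrange (Q G x y) (Σ⁺ t (weight H)) (Σ⁺ s xpow) (Σ⁺ t xpow) y ⟩
  Q G x y + (1# + Σ⁺ t (weight H)) + ((1# + Σ⁺ s xpow) - 1#) * ((1# + Σ⁺ t xpow) - 1#) * y - 1#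
    ≈⟨ +-congʳ (+-cong (+-congˡ (Q-split H))
         (*-congʳ (*-cong (+-congʳ (binomial-split s)) (+-congʳ (binomial-split t))))) ⟨
  Q G x y + Q H x y + (pow (1# + x) s - 1#) * (pow (1# + x) t - 1#) * y - 1# ∎
  where
  open CommutativeRing R
  open Poly R
  open Polynomials R
  open Join G H x y
  open import Relation.Binary.Reasoning.Setoid setoid
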